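{- Let $2 \leq m \leq n$ be integers and let $P_m, P_n$ denote the paths on $m$ and $n$ vertices. If $m, n \leq 3$ then $\sigma(P_m \,\Box\, P_n) = 2$; otherwise $\sigma(P_m \,\Box\, P_n) = 3$.
   Context: Surrounding Cops and Robbers on a finite simple graph $G$ with $k \geq 1$ cops and one robber: the cops first choose starting vertices (several cops may share a vertex), then the robber chooses a starting vertex not occupied by a cop, and thereafter the cops and the robber alternate moves, the cops moving first. In a move, each player may move to an adjacent vertex or stay put; the robber may never move to, or remain on, a vertex occupied by a cop, so if a cop moves onto the robber's vertex the robber is compelled to move to a neighbouring vertex not occupied by a cop. The cops win if at any time every neighbour of the robber's vertex is occupied by a cop; the robber wins if he avoids this forever. Play is with perfect information. The surrounding cop number $\sigma(G)$ is the least number of cops for which the cops have a winning strategy. $\Box$ denotes the Cartesian product of graphs: $(g,h)\sim(g',h')$ iff either $g=g'$ and $h\sim h'$, or $h=h'$ and $g\sim g'$. -}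

module Defs where

open import Data.Nat using (ℕ; zero; suc; _≤_; _<_)
open import Data.Fin using (Fin; toℕ)
open import Data.List using (List; []; _∷_; map)
open import Data.Product using (Σ; ∃; _×_; _,_)
open import Data.Sum using (_⊎_)
open import Relation.Binary.PropositionalEquality using (_≡_)
open import Relation.Nullary using (¬_)

record Graph : Set₁ where
  field
    V   : Set
    _∼_ : V → V → Set

open Graph public

Path : ℕ → Graph
Path n = record
  { V   = Fin n
  ; _∼_ = λ i j → (suc (toℕ i) ≡ toℕ j) ⊎ (suc (toℕ j) ≡ toℕ i)
  }

_□_ : Graph → Graph → Graph
G □ H = record
  { V   = V G × V H
  ; _∼_ = λ { (g , h) (g' , h') →
              (g ≡ g' × _∼_ H h h') ⊎ (h ≡ h' × _∼_ G g g') }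
  }

module _ (G : Graph) (k : ℕ) where

  Step : V G → V G → Set
  Step u v = (u ≡ v) ⊎ _∼_ G u v

  -- positions of the k cops (several may share a vertex)
  Config : Set
  Config = Fin k → V G

  Occupied : Config → V G → Set
  Occupied c v = ∃ λ i → c i ≡ v

  Surrounded : Config → V G → Set
  Surrounded c r = ∀ v → _∼_ G r v → Occupied c v

  record CopStrategy : Set where
    field
      start : Config
      next  : List (Config × V G) → Config → V G → Config
      legal : ∀ h c r (i : Fin k) → Step (c i) (next h c r i)

  open CopStrategy public

  history : (ℕ → Config) → (ℕ → V G) → ℕ → List (Config × V G)
  history c r zero    = []
  history c r (suc t) = (c t , r t) ∷ history c r t

  -- A play consistent with strategy S: c t = cops' positions and r t = robber's
  -- position after round t.  Round t+1: cops move (c t ↦ c (suc t)) according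
  -- to S, then the robber moves (r t ↦ r (suc t)) to an adjacent vertex or
  -- stays, never onto / remaining on a cop-occupied vertex.
  record Play (S : CopStrategy) : Set where
    field
      cops    : ℕ → Config
      robber  : ℕ → V G
      cops₀   : cops zero ≡ start S
      robber₀ : ¬ Occupied (cops zero) (robber zero)
      copsMv  : ∀ t → cops (suc t) ≡ next S (history cops robber t) (cops t) (robber t)
      robMv   : ∀ t → Step (robber t) (robber (suc t))
      robFree : ∀ t → ¬ Occupied (cops (suc t)) (robber (suc t))

  open Play public

  -- the robber is surrounded at some moment: either after a robber move
  -- (or placement), or right after a cop move
  SurroundedAt : {S : CopStrategy} → Play S → ℕ → Set
  SurroundedAt p t = Surrounded (cops p t) (robber p t)
                   ⊎ Surrounded (cops p (suc t)) (robber p t)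

  CopsWin : Set
  CopsWin = Σ CopStrategy λ S → (p : Play S) → ∃ λ t → SurroundedAt p t

SurroundingCopNumberIs : Graph → ℕ → Set
SurroundingCopNumberIs G k =
  (1 ≤ k) × CopsWin G k × (∀ j → 1 ≤ j → j < k → ¬ CopsWin G j)

module Submission where

-- The robber survives by staying in a safe region
-- (SafeRegion): against one cop anywhere, since every vertex has two
-- distinct neighbours; against two cops, when n ≥ 4, on the inner columns,
-- where every vertex has three distinct neighbours.
--
-- On the 2×2, 2×3 and 3×3 boards two cops follow explicit
-- memoryless rules that surround the robber within two rounds; this is
-- decided by evaluation (SmallBoard).  On every grid three cops win: a top
-- cop heads for the vertex above the robber, a left cop (its transpose) for
-- the vertex left of him, and a corner cop for the vertex diagonally
-- above-left.  Once all three are in place they close a trap that forces the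
-- robber down or to the right, after which they resume the chase, possibly
-- exchanging roles.  The measure (total lag of the top and left cops,
-- robber's distance to the bottom-right corner, lag of the corner cop)
-- drops lexicographically every round, so no play consistent with this
-- strategy can last forever (no-infinite-descent), i.e. the cops win.

open import Defs
open import Data.Nat using (ℕ; _≤_)
open import Data.Product using (_×_)
open import Relation.Nullary using (¬_)

open import Data.Bool using (Bool; true; false; _∧_)
open import Data.Empty using (⊥; ⊥-elim)
open import Data.Fin using (Fin; zero; suc; toℕ; fromℕ<; inject₁)
open import Data.Fin.Properties using (toℕ-injective; toℕ<n; toℕ-fromℕ<; toℕ-inject₁; all?; any?)
  renaming (_≟_ to _≟ᶠ_)
open import Data.List using (List; []; _∷_)
open import Data.Nat using (zero; suc; pred; _+_; _∸_; _<_; _<?_; _≟_; _≡ᵇ_; z≤n; s≤s; ∣_-_∣)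
open import Data.Nat.Induction using (<-wellFounded)
open import Data.Nat.Properties
open import Data.Product using (Σ; ∃; _,_; proj₁; proj₂; swap)
open import Data.Product.Properties using (≡-dec)
open import Data.Product.Relation.Binary.Lex.Strict using (×-Lex; ×-wellFounded)
open import Data.Sum using (_⊎_; inj₁; inj₂)
open import Data.Unit using (⊤; tt)
open import Induction.InfiniteDescent using (descent∧wf⇒empty)
open import Induction.WellFounded using (WellFounded)
open import Level using (0ℓ)
open import Relation.Binary.Core using (Rel)
open import Relation.Binary.PropositionalEquality
open import Relation.Nullary using (Dec; yes; no; does)
open import Relation.Nullary.Decidable using (_×-dec_; _⊎-dec_; _→-dec_; ¬?; toWitness)

module SafeRegion (G : Graph) (k : ℕ) (Safe : V G → Set)
  (safe-start : (c : Config G k) → Σ (V G) λ r → Safe r × ¬ Occupied G k c r)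
  (safe-unsurrounded : ∀ c r → Safe r → ¬ Surrounded G k c r)
  (safe-escape : ∀ c r → Safe r → Σ (V G) λ r' → Step G k r r' × Safe r' × ¬ Occupied G k c r')
  where

  record State : Set where
    field
      past    : List (Config G k × V G)
      cops′   : Config G k
      robber′ : V G
      safe    : Safe robber′
  open State

  module Against (S : CopStrategy G k) where

    copsReply : State → Config G k
    copsReply s = next S (past s) (cops′ s) (robber′ s)

    escape : (s : State) → Σ (V G) λ r' → Step G k (robber′ s) r' × Safe r' × ¬ Occupied G k (copsReply s) r'
    escape s = safe-escape (copsReply s) (robber′ s) (safe s)

    run : ℕ → State
    run zero = record { past = [] ; cops′ = start S ; robber′ = proj₁ (safe-start (start S))
                      ; safe = proj₁ (proj₂ (safe-start (start S))) }
    run (suc t) = record { past = (cops′ (run t) , robber′ (run t)) ∷ past (run t)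
                         ; cops′ = copsReply (run t) ; robber′ = proj₁ (escape (run t))
                         ; safe = proj₁ (proj₂ (proj₂ (escape (run t)))) }

    past-is-history : ∀ t → past (run t) ≡ history G k (λ t → cops′ (run t)) (λ t → robber′ (run t)) t
    past-is-history zero = refl
    past-is-history (suc t) = cong ((cops′ (run t) , robber′ (run t)) ∷_) (past-is-history t)

    play : Play G k S
    play = record
      { cops = λ t → cops′ (run t)
      ; robber = λ t → robber′ (run t)
      ; cops₀ = refl
      ; robber₀ = proj₂ (proj₂ (safe-start (start S)))
      ; copsMv = λ t → cong (λ h → next S h (cops′ (run t)) (robber′ (run t))) (past-is-history t)
      ; robMv = λ t → proj₁ (proj₂ (escape (run t)))
      ; robFree = λ t → proj₂ (proj₂ (proj₂ (escape (run t))))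
      }

  robber-evades : ¬ CopsWin G k
  robber-evades (S , wins) with wins (Against.play S)
  ... | t , inj₁ s = safe-unsurrounded _ _ (safe (Against.run S t)) s
  ... | t , inj₂ s = safe-unsurrounded _ _ (safe (Against.run S t)) s

module TwoRounds (G : Graph) (k : ℕ) (home : Config G k) (react : Config G k → V G → Config G k)
  (legal : ∀ c r i → Step G k (c i) (react c r i)) where

  WinsWithinTwoRounds : Set
  WinsWithinTwoRounds =
    ∀ r₀ → ¬ Occupied G k home r₀ →
      Surrounded G k (react home r₀) r₀
      ⊎ (∀ r₁ → Step G k r₀ r₁ → ¬ Occupied G k (react home r₀) r₁ →
           Surrounded G k (react (react home r₀) r₁) r₁)

  strategy : CopStrategy G k
  strategy = record { start = home ; next = λ _ → react ; legal = λ _ → legal }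

  module _ (p : Play G k strategy) where
    cops₁ : cops p 1 ≡ react home (robber p 0)
    cops₁ = trans (copsMv p 0) (cong (λ c → react c (robber p 0)) (cops₀ p))

    cops₂ : cops p 2 ≡ react (react home (robber p 0)) (robber p 1)
    cops₂ = trans (copsMv p 1) (cong (λ c → react c (robber p 1)) cops₁)

  two-round-win : WinsWithinTwoRounds → CopsWin G k
  two-round-win W = strategy , wins
    where
    wins : (p : Play G k strategy) → ∃ λ t → SurroundedAt G k p t
    wins p with W (robber p 0) (subst (λ c → ¬ Occupied G k c (robber p 0)) (cops₀ p) (robber₀ p))
    ... | inj₁ s = 0 , inj₂ (subst (λ c → Surrounded G k c (robber p 0)) (sym (cops₁ p)) s)
    ... | inj₂ W₁ = 1 , inj₂ (subst (λ c → Surrounded G k c (robber p 1)) (sym (cops₂ p))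
                               (W₁ (robber p 1) (robMv p 0)
                                   (subst (λ c → ¬ Occupied G k c (robber p 1)) (cops₁ p) (robFree p 0))))

no-infinite-descent : ∀ {A : Set} {_≺_ : Rel A 0ℓ} → WellFounded _≺_ →
  (Inv : ℕ → Set) (μ : ∀ {t} → Inv t → A) → Inv 0 →
  (∀ t (i : Inv t) → Σ (Inv (suc t)) λ i' → μ i' ≺ μ i) → ⊥
no-infinite-descent {A} {_≺_} wf Inv μ i₀ step =
  descent∧wf⇒empty descent wf (μ i₀) (0 , i₀ , refl)
  where
  Reached : A → Set
  Reached a = Σ ℕ λ t → Σ (Inv t) λ i → μ i ≡ a
  descent : ∀ {a} → Reached a → ∃ λ b → b ≺ a × Reached b
  descent (t , i , refl) = let (i' , lt) = step t i in μ i' , lt , (suc t , i' , refl)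

_≺³_ : Rel (ℕ × ℕ × ℕ) 0ℓ
_≺³_ = ×-Lex _≡_ _<_ (×-Lex _≡_ _<_ _<_)

≺³-wellFounded : WellFounded _≺³_
≺³-wellFounded = ×-wellFounded <-wellFounded (×-wellFounded <-wellFounded <-wellFounded)

module _ {a b c a' b' c' : ℕ} where
  ≺-by₁ : a < a' → (a , b , c) ≺³ (a' , b' , c')
  ≺-by₁ = inj₁

  ≺-by₂ : a ≡ a' → b < b' → (a , b , c) ≺³ (a' , b' , c')
  ≺-by₂ e q = inj₂ (e , inj₁ q)

  ≺-by₃ : a ≡ a' → b ≡ b' → c < c' → (a , b , c) ≺³ (a' , b' , c')
  ≺-by₃ e e' r = inj₂ (e , inj₂ (e' , r))

  ≺-by₂≤ : a ≤ a' → b < b' → (a , b , c) ≺³ (a' , b' , c')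
  ≺-by₂≤ p q with m≤n⇒m<n∨m≡n p
  ... | inj₁ p' = ≺-by₁ p'
  ... | inj₂ e = ≺-by₂ e q

  ≺-by₃≤ : a ≤ a' → b ≤ b' → c < c' → (a , b , c) ≺³ (a' , b' , c')
  ≺-by₃≤ p q r with m≤n⇒m<n∨m≡n p | m≤n⇒m<n∨m≡n q
  ... | inj₁ p' | _ = ≺-by₁ p'
  ... | inj₂ e | inj₁ q' = ≺-by₂ e q'
  ... | inj₂ e | inj₂ e' = ≺-by₃ e e' r

predF : ∀ {k} → Fin k → Fin k
predF zero = zero
predF (suc i) = inject₁ i

sucF : ∀ {k} → Fin k → Fin k
sucF {k} i with suc (toℕ i) <? k
... | yes p = fromℕ< p
... | no _ = i

toℕ-predF : ∀ {k} (i : Fin k) → toℕ (predF i) ≡ pred (toℕ i)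
toℕ-predF zero = refl
toℕ-predF (suc i) = toℕ-inject₁ i

toℕ-sucF : ∀ {k} (i : Fin k) → suc (toℕ i) < k → toℕ (sucF i) ≡ suc (toℕ i)
toℕ-sucF {k} i q with suc (toℕ i) <? k
... | yes p = toℕ-fromℕ< p
... | no np = ⊥-elim (np q)

predF-adj : ∀ {k} (i : Fin k) → 0 < toℕ i → _∼_ (Path k) i (predF i)
predF-adj (suc i) _ = inj₂ (cong suc (toℕ-inject₁ i))

sucF-adj : ∀ {k} (i : Fin k) → suc (toℕ i) < k → _∼_ (Path k) i (sucF i)
sucF-adj i q = inj₁ (sym (toℕ-sucF i q))

predF-step : ∀ {k} (i : Fin k) → (i ≡ predF i) ⊎ _∼_ (Path k) i (predF i)
predF-step zero = inj₁ refl
predF-step (suc i) = inj₂ (predF-adj (suc i) (s≤s z≤n))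

sucF-step : ∀ {k} (i : Fin k) → (i ≡ sucF i) ⊎ _∼_ (Path k) i (sucF i)
sucF-step {k} i with suc (toℕ i) <? k
... | yes p = inj₂ (inj₁ (sym (toℕ-fromℕ< p)))
... | no _ = inj₁ refl

predF≢sucF : ∀ {k} (i : Fin k) → suc (toℕ i) < k → predF i ≢ sucF i
predF≢sucF i q e = pred≢suc (toℕ i) (trans (sym (toℕ-predF i)) (trans (cong toℕ e) (toℕ-sucF i q)))
  where
  pred≢suc : ∀ y → pred y ≢ suc y
  pred≢suc zero ()
  pred≢suc (suc y) e = <-irrefl e (<-trans (n<1+n y) (n<1+n (suc y)))

neighbour : ∀ {a} (i : Fin (suc (suc a))) → Σ (Fin (suc (suc a))) (_∼_ (Path (suc (suc a))) i)
neighbour zero = suc zero , inj₁ refl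
neighbour (suc i) = inject₁ i , inj₂ (cong suc (toℕ-inject₁ i))

adjacent⇒distinct : ∀ {k} {i j : Fin k} → _∼_ (Path k) i j → i ≢ j
adjacent⇒distinct (inj₁ e) refl = 1+n≢n e
adjacent⇒distinct (inj₂ e) refl = 1+n≢n e

module GridGraph (a b : ℕ) where
  G : Graph
  G = Path a □ Path b

  Vx : Set
  Vx = Fin a × Fin b

  _≟V_ : (u v : Vx) → Dec (u ≡ v)
  _≟V_ = ≡-dec _≟ᶠ_ _≟ᶠ_

  pathAdjacent? : ∀ {k} (i j : Fin k) → Dec (_∼_ (Path k) i j)
  pathAdjacent? i j = (suc (toℕ i) ≟ toℕ j) ⊎-dec (suc (toℕ j) ≟ toℕ i)

  adjacent? : (u v : Vx) → Dec (_∼_ G u v)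
  adjacent? (g , h) (g' , h') = ((g ≟ᶠ g') ×-dec pathAdjacent? h h') ⊎-dec ((h ≟ᶠ h') ×-dec pathAdjacent? g g')

  step? : ∀ {k} (u v : Vx) → Dec (Step G k u v)
  step? u v = (u ≟V v) ⊎-dec adjacent? u v

  everyVertex? : {P : Vx → Set} → (∀ v → Dec (P v)) → Dec (∀ v → P v)
  everyVertex? P? with all? (λ i → all? (λ j → P? (i , j)))
  ... | yes f = yes λ v → f (proj₁ v) (proj₂ v)
  ... | no nf = no λ f → nf (λ i j → f (i , j))

  occupied? : ∀ {k} (c : Config G k) v → Dec (Occupied G k c v)
  occupied? c v = any? (λ i → c i ≟V v)

  surrounded? : ∀ {k} (c : Config G k) r → Dec (Surrounded G k c r)
  surrounded? c r = everyVertex? (λ v → adjacent? r v →-dec occupied? c v)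

  two-cops-miss-one : (c : Config G 2) {u v w : Vx} → u ≢ v → u ≢ w → v ≢ w →
                      ¬ Occupied G 2 c u ⊎ ¬ Occupied G 2 c v ⊎ ¬ Occupied G 2 c w
  two-cops-miss-one c {u} {v} {w} u≢v u≢w v≢w
    with occupied? c u | occupied? c v | occupied? c w
  ... | no free | _ | _ = inj₁ free
  ... | yes _ | no free | _ = inj₂ (inj₁ free)
  ... | yes _ | yes _ | no free = inj₂ (inj₂ free)
  ... | yes (i , refl) | yes (j , refl) | yes (l , refl) = ⊥-elim (pigeonhole i j l u≢v u≢w v≢w)
    where
    pigeonhole : ∀ i j l → c i ≢ c j → c i ≢ c l → c j ≢ c l → ⊥
    pigeonhole zero zero _ d _ _ = d refl
    pigeonhole (suc zero) (suc zero) _ d _ _ = d refl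
    pigeonhole zero (suc zero) zero _ d _ = d refl
    pigeonhole zero (suc zero) (suc zero) _ _ d = d refl
    pigeonhole (suc zero) zero zero _ _ d = d refl
    pigeonhole (suc zero) zero (suc zero) _ d _ = d refl

-- One cop never wins on a grid with at least two rows and two columns:
-- every vertex has two distinct neighbours, and the robber only moves
-- (to a neighbour) when the cop steps onto him.
one-cop-loses : ∀ a b → ¬ CopsWin (Path (suc (suc a)) □ Path (suc (suc b))) 1
one-cop-loses a b = SafeRegion.robber-evades G 1 (λ _ → ⊤) opening unsurrounded escape
  where
  open GridGraph (suc (suc a)) (suc (suc b))

  opening : (c : Config G 1) → Σ Vx λ r → ⊤ × ¬ Occupied G 1 c r
  opening c with c zero ≟V (zero , zero)
  ... | yes e = (suc zero , zero) , tt , λ { (zero , e') → 0≢1 (cong proj₁ (trans (sym e) e')) }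
    where
    0≢1 : _≢_ {A = Fin (suc (suc a))} zero (suc zero)
    0≢1 ()
  ... | no ne = (zero , zero) , tt , λ { (zero , e') → ne e' }

  unsurrounded : ∀ c r → ⊤ → ¬ Surrounded G 1 c r
  unsurrounded c (i , j) _ sur
    with sur (proj₁ (neighbour i) , j) (inj₂ (refl , proj₂ (neighbour i)))
       | sur (i , proj₁ (neighbour j)) (inj₁ (refl , proj₂ (neighbour j)))
  ... | zero , eu | zero , ev = adjacent⇒distinct (proj₂ (neighbour j)) (cong proj₂ (trans (sym eu) ev))

  escape : ∀ c r → ⊤ → Σ Vx λ r' → Step G 1 r r' × ⊤ × ¬ Occupied G 1 c r'
  escape c (i , j) _ with c zero ≟V (i , j)
  ... | yes e = (proj₁ (neighbour i) , j) , inj₂ (inj₂ (refl , proj₂ (neighbour i))) , tt ,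
                λ { (zero , e') → adjacent⇒distinct (proj₂ (neighbour i)) (cong proj₁ (trans (sym e) e')) }
  ... | no ne = (i , j) , inj₁ refl , tt , λ { (zero , e') → ne e' }

-- Two cops never win on P m □ P n with m ≥ 2 and n ≥ 4: the robber stays
-- off the two boundary columns, where every vertex has three distinct
-- neighbours and, besides itself, two safe neighbours.
two-cops-lose : ∀ a b → ¬ CopsWin (Path (suc (suc a)) □ Path (suc (suc (suc (suc b))))) 2
two-cops-lose a b = SafeRegion.robber-evades G 2 Safe opening unsurrounded escape
  where
  N : ℕ
  N = suc (suc (suc (suc b)))
  open GridGraph (suc (suc a)) N

  Safe : Vx → Set
  Safe (i , j) = 0 < toℕ j × suc (toℕ j) < N

  sideways : ∀ i j → Safe (i , j) → Σ (Fin N) λ j' → _∼_ (Path N) j j' × Safe (i , j')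
  sideways i j (pos , room) with suc (suc (toℕ j)) <? N
  ... | yes room₂ = sucF j , sucF-adj j room ,
                    subst (0 <_) (sym (toℕ-sucF j room)) (s≤s z≤n) ,
                    subst (λ z → suc z < N) (sym (toℕ-sucF j room)) room₂
  ... | no noRoom₂ = predF j , predF-adj j pos ,
                     subst (0 <_) (sym (toℕ-predF j)) (far (toℕ j) noRoom₂ pos) ,
                     subst (λ z → suc z < N) (sym (toℕ-predF j)) (near (toℕ j) pos room)
    where
    near : ∀ y → 0 < y → suc y < N → suc (pred y) < N
    near (suc y) _ r = <-trans (n<1+n _) r
    far : ∀ y → ¬ (suc (suc y) < N) → 0 < y → 0 < pred y
    far (suc zero) noRoom _ = ⊥-elim (noRoom (s≤s (s≤s (s≤s (s≤s z≤n)))))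
    far (suc (suc y)) _ _ = s≤s z≤n

  opening : (c : Config G 2) → Σ Vx λ r → Safe r × ¬ Occupied G 2 c r
  opening c with two-cops-miss-one c {zero , suc zero} {zero , suc (suc zero)} {suc zero , suc zero}
                 (λ ()) (λ ()) (λ ())
  ... | inj₁ free = _ , (s≤s z≤n , s≤s (s≤s (s≤s z≤n))) , free
  ... | inj₂ (inj₁ free) = _ , (s≤s z≤n , s≤s (s≤s (s≤s (s≤s z≤n)))) , free
  ... | inj₂ (inj₂ free) = _ , (s≤s z≤n , s≤s (s≤s (s≤s z≤n))) , free

  unsurrounded : ∀ c r → Safe r → ¬ Surrounded G 2 c r
  unsurrounded c (i , j) (pos , room) sur
    with two-cops-miss-one c {proj₁ (neighbour i) , j} {i , predF j} {i , sucF j}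
           (λ e → adjacent⇒distinct (proj₂ (neighbour i)) (sym (cong proj₁ e)))
           (λ e → adjacent⇒distinct (proj₂ (neighbour i)) (sym (cong proj₁ e)))
           (λ e → predF≢sucF j room (cong proj₂ e))
  ... | inj₁ free = free (sur _ (inj₂ (refl , proj₂ (neighbour i))))
  ... | inj₂ (inj₁ free) = free (sur _ (inj₁ (refl , predF-adj j pos)))
  ... | inj₂ (inj₂ free) = free (sur _ (inj₁ (refl , sucF-adj j room)))

  escape : ∀ c r → Safe r → Σ Vx λ r' → Step G 2 r r' × Safe r' × ¬ Occupied G 2 c r'
  escape c (i , j) safe with sideways i j safe
  ... | j' , j∼j' , safe' with two-cops-miss-one c {i , j} {proj₁ (neighbour i) , j} {i , j'}
                                 (λ e → adjacent⇒distinct (proj₂ (neighbour i)) (cong proj₁ e))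
                                 (λ e → adjacent⇒distinct j∼j' (cong proj₂ e))
                                 (λ e → adjacent⇒distinct (proj₂ (neighbour i)) (sym (cong proj₁ e)))
  ... | inj₁ free = (i , j) , inj₁ refl , safe , free
  ... | inj₂ (inj₁ free) = _ , inj₂ (inj₂ (refl , proj₂ (neighbour i))) , safe , free
  ... | inj₂ (inj₂ free) = _ , inj₂ (inj₁ (refl , j∼j')) , safe' , free

module SmallBoard (a b : ℕ) where
  open GridGraph a b public

  towards : Vx → Vx → Vx
  towards p q with step? {0} p q
  ... | yes _ = q
  ... | no _ = p

  towards-step : ∀ {k} p q → Step G k p (towards p q)
  towards-step p q with step? {0} p q
  ... | yes s = s
  ... | no _ = inj₁ refl

  module Rule (home : Config G 2) (target : Config G 2 → Vx → Fin 2 → Vx) where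
    react : Config G 2 → Vx → Config G 2
    react c r i = towards (c i) (target c r i)

    open TwoRounds G 2 home react (λ c r i → towards-step {2} (c i) (target c r i)) public

    winsWithinTwoRounds? : Dec WinsWithinTwoRounds
    winsWithinTwoRounds? =
      everyVertex? λ r₀ → ¬? (occupied? home r₀) →-dec
        (surrounded? (react home r₀) r₀ ⊎-dec
         everyVertex? λ r₁ → step? {2} r₀ r₁ →-dec (¬? (occupied? (react home r₀) r₁) →-dec
                                                   surrounded? (react (react home r₀) r₁) r₁))

-- P2 □ P2: two cops on opposite corners stay put.
two-cops-win-2×2 : CopsWin (Path 2 □ Path 2) 2
two-cops-win-2×2 = two-round-win (toWitness {a? = winsWithinTwoRounds?} tt)
  where
  open SmallBoard 2 2
  home : Config G 2
  home zero = (zero , zero)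
  home (suc zero) = (suc zero , suc zero)
  open Rule home (λ c r i → c i)

-- P2 □ P3: the cops start in the middle column, one in each row.  The cop
-- in the robber's row keeps to the middle column while the other cop moves
-- into the robber's column.
two-cops-win-2×3 : CopsWin (Path 2 □ Path 3) 2
two-cops-win-2×3 = two-round-win (toWitness {a? = winsWithinTwoRounds?} tt)
  where
  open SmallBoard 2 3
  home : Config G 2
  home zero = (zero , suc zero)
  home (suc zero) = (suc zero , suc zero)
  target : Config G 2 → Vx → Fin 2 → Vx
  target c (zero , y) zero = (zero , suc zero)
  target c (suc zero , y) zero = (zero , y)
  target c (zero , y) (suc zero) = (suc zero , y)
  target c (suc zero , y) (suc zero) = (suc zero , suc zero)
  open Rule home target

-- P3 □ P3: both cops start in the centre.  A robber in a corner gets both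
-- of its neighbours covered; otherwise one cop returns to the centre and
-- the other heads for the robber.
two-cops-win-3×3 : CopsWin (Path 3 □ Path 3) 2
two-cops-win-3×3 = two-round-win (toWitness {a? = winsWithinTwoRounds?} tt)
  where
  open SmallBoard 3 3
  centre : Vx
  centre = (suc zero , suc zero)
  cover : Config G 2 → Vx → Vx → Fin 2 → Vx
  cover c u v zero with c (suc zero) ≟V u
  ... | yes _ = v
  ... | no _ = u
  cover c u v (suc zero) with c (suc zero) ≟V u
  ... | yes _ = u
  ... | no _ = v
  target : Config G 2 → Vx → Fin 2 → Vx
  target c (zero , zero) = cover c (suc zero , zero) (zero , suc zero)
  target c (zero , suc (suc zero)) = cover c (suc zero , suc (suc zero)) (zero , suc zero)
  target c (suc (suc zero) , zero) = cover c (suc zero , zero) (suc (suc zero) , suc zero)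
  target c (suc (suc zero) , suc (suc zero)) = cover c (suc zero , suc (suc zero)) (suc (suc zero) , suc zero)
  target c (suc zero , suc zero) = c
  target c r zero = centre
  target c r (suc zero) = r
  open Rule (λ _ → centre) target

-- The three-cop strategy is first described and analysed in the plane ℕ²,
-- then transported to the grid (ThreeCops).  Points of ℕ² are
-- (row , column); rows grow downwards.
Pt : Set
Pt = ℕ × ℕ

data Dir : Set where
  hold north south west east : Dir

shift : Dir → Pt → Pt
shift hold p = p
shift north (a , b) = (pred a , b)
shift south (a , b) = (suc a , b)
shift west (a , b) = (a , pred b)
shift east (a , b) = (a , suc b)

transposeDir : Dir → Dir
transposeDir hold = hold
transposeDir north = west
transposeDir south = east
transposeDir west = north
transposeDir east = south

shift-transpose : ∀ d p → shift (transposeDir d) (swap p) ≡ swap (shift d p)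
shift-transpose hold p = refl
shift-transpose north p = refl
shift-transpose south p = refl
shift-transpose west p = refl
shift-transpose east p = refl

data Move : ℕ → ℕ → ℕ → ℕ → Set where
  stay  : ∀ {x y} → Move x y x y
  up    : ∀ {x y} → Move (suc x) y x y
  down  : ∀ {x y} → Move x y (suc x) y
  left  : ∀ {x y} → Move x (suc y) x y
  right : ∀ {x y} → Move x y x (suc y)

transposeMove : ∀ {x y x' y'} → Move x y x' y' → Move y x y' x'
transposeMove stay = stay
transposeMove up = left
transposeMove down = right
transposeMove left = up
transposeMove right = down

-- The top cop aims at the vertex right above the robber at (x , y), or, if
-- the robber is in row 0, at the vertex left of him; this is its aim column.
aimCol : ℕ → ℕ → ℕ
aimCol zero y = pred y
aimCol (suc x) y = y

aimCol≤ : ∀ x y → aimCol x y ≤ y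
aimCol≤ zero y = pred[n]≤n
aimCol≤ (suc x) y = ≤-refl

-- The top cop at (a , b) first walks to the aim column, then descends
-- towards the robber's row.  The rule is abstract: proofs use it only
-- through the characterising lemmas below.
abstract
  topDir : ℕ → ℕ → ℕ → ℕ → Dir
  topDir a b x y with b <? aimCol x y | aimCol x y <? b | suc a <? x
  ... | yes _ | _ | _ = east
  ... | no _ | yes _ | _ = west
  ... | no _ | no _ | yes _ = south
  ... | no _ | no _ | no _ = hold

  topDir-east : ∀ {a b x y} → b < aimCol x y → topDir a b x y ≡ east
  topDir-east {a} {b} {x} {y} p with b <? aimCol x y
  ... | yes _ = refl
  ... | no q = ⊥-elim (q p)

  topDir-west : ∀ {a b x y} → aimCol x y < b → topDir a b x y ≡ west
  topDir-west {a} {b} {x} {y} p with b <? aimCol x y | aimCol x y <? b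
  ... | yes q | _ = ⊥-elim (<-asym p q)
  ... | no _ | yes _ = refl
  ... | no _ | no q = ⊥-elim (q p)

  topDir-south : ∀ {a b x y} → b ≡ aimCol x y → suc a < x → topDir a b x y ≡ south
  topDir-south {a} {b} {x} {y} e p with b <? aimCol x y | aimCol x y <? b | suc a <? x
  ... | yes q | _ | _ = ⊥-elim (<-irrefl e q)
  ... | no _ | yes q | _ = ⊥-elim (<-irrefl (sym e) q)
  ... | no _ | no _ | yes _ = refl
  ... | no _ | no _ | no q = ⊥-elim (q p)

  topDir-hold : ∀ {a b x y} → b ≡ aimCol x y → ¬ suc a < x → topDir a b x y ≡ hold
  topDir-hold {a} {b} {x} {y} e p with b <? aimCol x y | aimCol x y <? b | suc a <? x
  ... | yes q | _ | _ = ⊥-elim (<-irrefl e q)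
  ... | no _ | yes q | _ = ⊥-elim (<-irrefl (sym e) q)
  ... | no _ | no _ | yes q = ⊥-elim (p q)
  ... | no _ | no _ | no _ = refl

  topDir-bounded : ∀ a b x y → (topDir a b x y ≡ east → b < aimCol x y) × (topDir a b x y ≡ south → suc a < x)
  topDir-bounded a b x y with b <? aimCol x y | aimCol x y <? b | suc a <? x
  ... | yes p | _ | _ = (λ _ → p) , λ ()
  ... | no _ | yes _ | _ = (λ ()) , (λ ())
  ... | no _ | no _ | yes p = (λ ()) , λ _ → p
  ... | no _ | no _ | no _ = (λ ()) , (λ ())

topMove : ℕ → ℕ → ℕ → ℕ → Pt
topMove a b x y = shift (topDir a b x y) (a , b)

topMove-east : ∀ {a b x y} → b < aimCol x y → topMove a b x y ≡ (a , suc b)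
topMove-east {a} {b} p = cong (λ d → shift d (a , b)) (topDir-east p)

topMove-west : ∀ {a b x y} → aimCol x y < b → topMove a b x y ≡ (a , pred b)
topMove-west {a} {b} p = cong (λ d → shift d (a , b)) (topDir-west p)

topMove-south : ∀ {a b x y} → b ≡ aimCol x y → suc a < x → topMove a b x y ≡ (suc a , b)
topMove-south {a} {b} e p = cong (λ d → shift d (a , b)) (topDir-south e p)

topMove-hold : ∀ {a b x y} → b ≡ aimCol x y → ¬ suc a < x → topMove a b x y ≡ (a , b)
topMove-hold {a} {b} e p = cong (λ d → shift d (a , b)) (topDir-hold e p)

-- The invariant of a top cop at (a , b) with the robber at (x , y): the
-- cop is never below the robber and never right of its aim column.
data TopInv (a b x y : ℕ) : Set where
  left-in-row0 : (h : ℕ) → a ≡ 0 → x ≡ 0 → y ≡ suc (h + b) → TopInv a b x y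
  top-row : (h x₀ : ℕ) → a ≡ 0 → x ≡ suc x₀ → y ≡ h + b → TopInv a b x y
  in-column : (g : ℕ) → b ≡ y → x ≡ suc (g + a) → TopInv a b x y

-- the number of cop moves still needed to reach the aim
lag : ∀ {a b x y} → TopInv a b x y → ℕ
lag (left-in-row0 h _ _ _) = h
lag (top-row h x₀ _ _ _) = h + x₀
lag (in-column g _ _) = g

lag0⇒aim : ∀ {a b x y} (j : TopInv a b x y) → lag j ≡ 0 → a ≡ pred x × b ≡ aimCol x y
lag0⇒aim (left-in-row0 zero refl refl refl) _ = refl , refl
lag0⇒aim (top-row zero zero refl refl refl) _ = refl , refl
lag0⇒aim (in-column zero refl refl) _ = refl , refl

TopInv-off-origin : ∀ {a b x y} → TopInv a b x y → ¬ (x ≡ 0 × y ≡ 0)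
TopInv-off-origin (left-in-row0 h _ refl refl) (_ , ())
TopInv-off-origin (top-row h x₀ _ refl _) (() , _)
TopInv-off-origin (in-column g _ refl) (() , _)

Shrinks : ∀ {x y x' y'} → Move x y x' y' → ℕ → ℕ → Set
Shrinks stay l' l = l' < l ⊎ l ≡ 0
Shrinks up l' l = l' < l
Shrinks down _ _ = ⊤
Shrinks left _ _ = ⊤
Shrinks right _ _ = ⊤

record TopRound {a b x y x' y'} (j : TopInv a b x y) (mv : Move x y x' y') (p : Pt) : Set where
  constructor topRound
  field
    inv     : TopInv (proj₁ p) (proj₂ p) x' y'
    lag≤    : lag inv ≤ lag j
    shrinks : Shrinks mv (lag inv) (lag j)

top-round-column : ∀ {a y x' y'} g (mv : Move (suc (g + a)) y x' y') → ¬ (x' ≡ a × y' ≡ y) →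
                   TopRound (in-column g refl refl) mv (topMove a y x' y')
top-round-column {a} {y} zero stay _
  rewrite topMove-hold {a} {y} {suc a} {y} refl (n≮n (suc a)) = topRound (in-column 0 refl refl) z≤n (inj₂ refl)
top-round-column {a} {y} (suc g) stay _
  rewrite topMove-south {a} {y} {suc (suc (g + a))} {y} refl (s≤s (s≤s (m≤n+m a g)))
  = topRound (in-column g refl (cong suc (sym (+-suc g a)))) (n≤1+n g) (inj₁ ≤-refl)
top-round-column zero up caught = ⊥-elim (caught (refl , refl))
top-round-column {a} {y} (suc zero) up _
  rewrite topMove-hold {a} {y} {suc a} {y} refl (n≮n (suc a)) = topRound (in-column 0 refl refl) z≤n ≤-refl
top-round-column {a} {y} (suc (suc g)) up _
  rewrite topMove-south {a} {y} {suc (suc (g + a))} {y} refl (s≤s (s≤s (m≤n+m a g)))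
  = topRound (in-column g refl (cong suc (sym (+-suc g a)))) (m≤n⇒m≤1+n (n≤1+n g)) (n≤1+n (suc g))
top-round-column {a} {y} g down _
  rewrite topMove-south {a} {y} {suc (suc (g + a))} {y} refl (s≤s (s≤s (m≤n+m a g)))
  = topRound (in-column g refl (cong suc (sym (+-suc g a)))) ≤-refl tt
top-round-column {a} {suc y} g left _
  rewrite topMove-west {a} {suc y} {suc (g + a)} {y} ≤-refl = topRound (in-column g refl refl) ≤-refl tt
top-round-column {a} {y} g right _
  rewrite topMove-east {a} {y} {suc (g + a)} {suc y} ≤-refl = topRound (in-column g refl refl) ≤-refl tt

top-round-top-row : ∀ {b x' y'} h x₀ (mv : Move (suc x₀) (h + b) x' y') → ¬ (x' ≡ 0 × y' ≡ b) →
                    TopRound (top-row h x₀ refl refl refl) mv (topMove 0 b x' y')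
top-round-top-row {b} (suc h) x₀ stay _
  rewrite topMove-east {0} {b} {suc x₀} {suc (h + b)} (s≤s (m≤n+m b h))
  = topRound (top-row h x₀ refl refl (sym (+-suc h b))) (n≤1+n _) (inj₁ ≤-refl)
top-round-top-row {b} zero zero stay _
  rewrite topMove-hold {0} {b} {1} {b} refl (n≮n 1) = topRound (in-column 0 refl refl) z≤n (inj₂ refl)
top-round-top-row {b} zero (suc x₁) stay _
  rewrite topMove-south {0} {b} {suc (suc x₁)} {b} refl (s≤s (s≤s z≤n))
  = topRound (in-column x₁ refl (cong suc (+-comm 1 x₁))) (n≤1+n x₁) (inj₁ ≤-refl)
top-round-top-row zero zero up caught = ⊥-elim (caught (refl , refl))
top-round-top-row {b} (suc zero) zero up _
  rewrite topMove-hold {0} {b} {0} {suc b} refl (λ ()) = topRound (left-in-row0 0 refl refl refl) z≤n ≤-refl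
top-round-top-row {b} (suc (suc h)) zero up _
  rewrite topMove-east {0} {b} {0} {suc (suc (h + b))} (s≤s (m≤n+m b h))
  = topRound (left-in-row0 h refl refl (cong suc (sym (+-suc h b))))
             (≤-trans (m≤n⇒m≤1+n (n≤1+n h)) (≤-reflexive (sym (+-identityʳ _))))
             (≤-trans (n≤1+n (suc h)) (≤-reflexive (sym (+-identityʳ _))))
top-round-top-row {b} (suc h) (suc x₁) up _
  rewrite topMove-east {0} {b} {suc x₁} {suc (h + b)} (s≤s (m≤n+m b h))
  = topRound (top-row h x₁ refl refl (sym (+-suc h b)))
             (m≤n⇒m≤1+n (+-monoʳ-≤ h (n≤1+n x₁))) (s≤s (+-monoʳ-≤ h (n≤1+n x₁)))
top-round-top-row {b} zero (suc zero) up _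
  rewrite topMove-hold {0} {b} {1} {b} refl (n≮n 1) = topRound (in-column 0 refl refl) z≤n (s≤s z≤n)
top-round-top-row {b} zero (suc (suc x₂)) up _
  rewrite topMove-south {0} {b} {suc (suc x₂)} {b} refl (s≤s (s≤s z≤n))
  = topRound (in-column x₂ refl (cong suc (+-comm 1 x₂))) (m≤n⇒m≤1+n (n≤1+n x₂)) (n≤1+n (suc x₂))
top-round-top-row {b} (suc h) x₀ down _
  rewrite topMove-east {0} {b} {suc (suc x₀)} {suc (h + b)} (s≤s (m≤n+m b h))
  = topRound (top-row h (suc x₀) refl refl (sym (+-suc h b))) (≤-reflexive (+-suc h x₀)) tt
top-round-top-row {b} zero x₀ down _
  rewrite topMove-south {0} {b} {suc (suc x₀)} {b} refl (s≤s (s≤s z≤n))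
  = topRound (in-column x₀ refl (cong suc (+-comm 1 x₀))) ≤-refl tt
top-round-top-row {suc y} zero x₀ left _
  rewrite topMove-west {0} {suc y} {suc x₀} {y} ≤-refl = topRound (top-row 0 x₀ refl refl refl) ≤-refl tt
top-round-top-row {b} (suc (suc h)) x₀ left _
  rewrite topMove-east {0} {b} {suc x₀} {suc (h + b)} (s≤s (m≤n+m b h))
  = topRound (top-row h x₀ refl refl (sym (+-suc h b))) (m≤n⇒m≤1+n (n≤1+n _)) tt
top-round-top-row {b} (suc zero) zero left _
  rewrite topMove-hold {0} {b} {1} {b} refl (n≮n 1) = topRound (in-column 0 refl refl) z≤n tt
top-round-top-row {b} (suc zero) (suc x₁) left _
  rewrite topMove-south {0} {b} {suc (suc x₁)} {b} refl (s≤s (s≤s z≤n))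
  = topRound (in-column x₁ refl (cong suc (+-comm 1 x₁))) (m≤n⇒m≤1+n (n≤1+n x₁)) tt
top-round-top-row {b} h x₀ right _
  rewrite topMove-east {0} {b} {suc x₀} {suc (h + b)} (s≤s (m≤n+m b h))
  = topRound (top-row h x₀ refl refl (sym (+-suc h b))) ≤-refl tt

top-round-row0 : ∀ {b x' y'} h (mv : Move 0 (suc (h + b)) x' y') → ¬ (x' ≡ 0 × y' ≡ b) →
                 TopRound (left-in-row0 h refl refl refl) mv (topMove 0 b x' y')
top-round-row0 {b} (suc h) stay _
  rewrite topMove-east {0} {b} {0} {suc (suc (h + b))} (s≤s (m≤n+m b h))
  = topRound (left-in-row0 h refl refl (cong suc (sym (+-suc h b)))) (n≤1+n h) (inj₁ ≤-refl)
top-round-row0 {b} zero stay _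
  rewrite topMove-hold {0} {b} {0} {suc b} refl (λ ()) = topRound (left-in-row0 0 refl refl refl) z≤n (inj₂ refl)
top-round-row0 {b} h down _
  rewrite topMove-east {0} {b} {1} {suc (h + b)} (s≤s (m≤n+m b h))
  = topRound (top-row h 0 refl refl (sym (+-suc h b))) (≤-reflexive (+-identityʳ h)) tt
top-round-row0 zero left caught = ⊥-elim (caught (refl , refl))
top-round-row0 {b} (suc zero) left _
  rewrite topMove-hold {0} {b} {0} {suc b} refl (λ ()) = topRound (left-in-row0 0 refl refl refl) z≤n tt
top-round-row0 {b} (suc (suc h)) left _
  rewrite topMove-east {0} {b} {0} {suc (suc (h + b))} (s≤s (m≤n+m b h))
  = topRound (left-in-row0 h refl refl (cong suc (sym (+-suc h b)))) (m≤n⇒m≤1+n (n≤1+n h)) tt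
top-round-row0 {b} h right _
  rewrite topMove-east {0} {b} {0} {suc (suc (h + b))} (s≤s (m≤n+m b h))
  = topRound (left-in-row0 h refl refl (cong suc (sym (+-suc h b)))) ≤-refl tt

top-round : ∀ {a b x y x' y'} (j : TopInv a b x y) (mv : Move x y x' y') → ¬ (x' ≡ a × y' ≡ b) →
            TopRound j mv (topMove a b x' y')
top-round (left-in-row0 h refl refl refl) = top-round-row0 h
top-round (top-row h x₀ refl refl refl) = top-round-top-row h x₀
top-round (in-column g refl refl) = top-round-column g

-- The corner cop walks straight to the vertex diagonally above-left of
-- the robber, (x - 1 , y - 1); its corner lag is the ℓ¹ distance to it.
∣suc-∣< : ∀ a t → a < t → ∣ suc a - t ∣ < ∣ a - t ∣
∣suc-∣< zero (suc t) _ = ≤-refl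
∣suc-∣< (suc a) (suc t) (s≤s p) = ∣suc-∣< a t p

∣pred-∣< : ∀ a t → t < a → ∣ pred a - t ∣ < ∣ a - t ∣
∣pred-∣< (suc zero) zero _ = s≤s z≤n
∣pred-∣< (suc (suc a)) zero _ = ≤-refl
∣pred-∣< (suc zero) (suc t) (s≤s ())
∣pred-∣< (suc (suc a)) (suc t) (s≤s p) = ∣pred-∣< (suc a) t p

cornerLag : Pt → ℕ → ℕ → ℕ
cornerLag (c₁ , c₂) x y = ∣ c₁ - pred x ∣ + ∣ c₂ - pred y ∣

-- a move from p stays inside the grid with rows < m and columns < n
-- (only moving south or east can leave it)
InBounds : ℕ → ℕ → Dir → Pt → Set
InBounds m n south (a , b) = suc a < m
InBounds m n east (a , b) = suc b < n
InBounds m n _ _ = ⊤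

abstract
  cornerDir : ℕ → ℕ → ℕ → ℕ → Dir
  cornerDir c₁ c₂ x y with c₁ <? pred x | pred x <? c₁ | c₂ <? pred y | pred y <? c₂
  ... | yes _ | _ | _ | _ = south
  ... | no _ | yes _ | _ | _ = north
  ... | no _ | no _ | yes _ | _ = east
  ... | no _ | no _ | no _ | yes _ = west
  ... | no _ | no _ | no _ | no _ = hold

  cornerDir-approaches : ∀ c₁ c₂ x y → ¬ (c₁ ≡ pred x × c₂ ≡ pred y) →
                         cornerLag (shift (cornerDir c₁ c₂ x y) (c₁ , c₂)) x y < cornerLag (c₁ , c₂) x y
  cornerDir-approaches c₁ c₂ x y off with c₁ <? pred x | pred x <? c₁ | c₂ <? pred y | pred y <? c₂
  ... | yes p | _ | _ | _ = +-mono-<-≤ (∣suc-∣< c₁ (pred x) p) ≤-refl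
  ... | no _ | yes p | _ | _ = +-mono-<-≤ (∣pred-∣< c₁ (pred x) p) ≤-refl
  ... | no _ | no _ | yes p | _ = +-mono-≤-< ≤-refl (∣suc-∣< c₂ (pred y) p)
  ... | no _ | no _ | no _ | yes p = +-mono-≤-< ≤-refl (∣pred-∣< c₂ (pred y) p)
  ... | no p | no q | no r | no s = ⊥-elim (off (≤-antisym (≮⇒≥ q) (≮⇒≥ p) , ≤-antisym (≮⇒≥ s) (≮⇒≥ r)))

  cornerDir-inBounds : ∀ m n c₁ c₂ x y → x < m → y < n → InBounds m n (cornerDir c₁ c₂ x y) (c₁ , c₂)
  cornerDir-inBounds m n c₁ c₂ x y xm yn with c₁ <? pred x | pred x <? c₁ | c₂ <? pred y | pred y <? c₂
  ... | yes p | _ | _ | _ = ≤-<-trans p (≤-<-trans pred[n]≤n xm)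
  ... | no _ | yes _ | _ | _ = tt
  ... | no _ | no _ | yes p | _ = ≤-<-trans p (≤-<-trans pred[n]≤n yn)
  ... | no _ | no _ | no _ | yes _ = tt
  ... | no _ | no _ | no _ | no _ = tt

-- The three cops A (top), B (left: the transpose of a top cop) and C
-- (corner) are aligned when all three stand at their aims.
Aligned : Pt → Pt → Pt → Pt → Set
Aligned (ax , ay) (bx , by) (cx , cy) (x , y) =
  ¬ (x ≡ 0 × y ≡ 0) × (ax ≡ pred x × ay ≡ aimCol x y) × (bx ≡ aimCol y x × by ≡ pred y)
  × (0 < x → 0 < y → cx ≡ pred x × cy ≡ pred y)

abstract
  aligned? : ∀ A B C r → Dec (Aligned A B C r)
  aligned? (ax , ay) (bx , by) (cx , cy) (x , y) =
    ¬? ((x ≟ 0) ×-dec (y ≟ 0)) ×-dec ((ax ≟ pred x) ×-dec (ay ≟ aimCol x y)) ×-dec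
    ((bx ≟ aimCol y x) ×-dec (by ≟ pred y)) ×-dec ((0 <? x) →-dec ((0 <? y) →-dec ((cx ≟ pred x) ×-dec (cy ≟ pred y))))

-- When aligned, the cops close the trap: one cop steps onto the robber
-- while the others cover his up and left neighbours.
closingDirs : ℕ → ℕ → Dir × Dir × Dir
closingDirs zero y = (east , hold , hold)
closingDirs (suc x) zero = (hold , south , hold)
closingDirs (suc x) (suc y) = (south , hold , east)

-- A closed trap around the robber at r: a cop stands on him and the others
-- block his up and left neighbours (or the border does), so he must leave
-- down or to the right.
data Trap : Pt → Pt → Pt → Pt → Set where
  trap-inner : ∀ x₀ y₀ → Trap (suc x₀ , suc y₀) (suc x₀ , y₀) (x₀ , suc y₀) (suc x₀ , suc y₀)
  trap-row0 : ∀ y₀ C → Trap (0 , suc y₀) (0 , y₀) C (0 , suc y₀)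
  trap-col0 : ∀ x₀ C → Trap (x₀ , 0) (suc x₀ , 0) C (suc x₀ , 0)

closing-traps : ∀ A B C r → Aligned A B C r →
  Trap (shift (proj₁ (closingDirs (proj₁ r) (proj₂ r))) A) (shift (proj₁ (proj₂ (closingDirs (proj₁ r) (proj₂ r)))) B)
       (shift (proj₂ (proj₂ (closingDirs (proj₁ r) (proj₂ r)))) C) r
closing-traps A B C (zero , zero) (off , _) = ⊥-elim (off (refl , refl))
closing-traps _ _ C (zero , suc y₀) (_ , (refl , refl) , (refl , refl) , _) = trap-row0 y₀ C
closing-traps _ _ C (suc x₀ , zero) (_ , (refl , refl) , (refl , refl) , _) = trap-col0 x₀ C
closing-traps _ _ (cx , cy) (suc x₀ , suc y₀) (_ , (refl , refl) , (refl , refl) , corner)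
  with corner (s≤s z≤n) (s≤s z≤n)
... | refl , refl = trap-inner x₀ y₀

Phase : Bool → Pt → Pt → Pt → Pt → Set
Phase false (ax , ay) (bx , by) C (x , y) = TopInv ax ay x y × TopInv by bx y x
Phase true A B C r = Trap A B C r

toCorner : ℕ → ℕ → Pt → ℕ
toCorner m n (x , y) = (m ∸ x) + (n ∸ y)

toCorner-south : ∀ m n x y → suc x < m → toCorner m n (suc x , y) < toCorner m n (x , y)
toCorner-south m n x y p = +-mono-<-≤ (∸-monoʳ-< (n<1+n x) (<⇒≤ p)) ≤-refl

toCorner-east : ∀ m n x y → suc y < n → toCorner m n (x , suc y) < toCorner m n (x , y)
toCorner-east m n x y p = +-mono-≤-< (≤-refl {m ∸ x}) (∸-monoʳ-< (n<1+n y) (<⇒≤ p))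

measure : ℕ → ℕ → (b : Bool) → ∀ A B C r → Phase b A B C r → ℕ × ℕ × ℕ
measure m n false A B C r (ja , jb) = (lag ja + lag jb , toCorner m n r , suc (cornerLag C (proj₁ r) (proj₂ r)))
measure m n true A B C r _ = (0 , toCorner m n r , 0)

-- After an inner trap the robber may escape to the right; then the cops
-- exchange roles: the corner cop becomes the top cop, the top cop the left
-- cop and the left cop the corner cop.
rotates : Bool → Pt → Pt → Bool
rotates closed (x , y) (x' , y') = closed ∧ positive x ∧ positive y ∧ (x' ≡ᵇ x) ∧ (y' ≡ᵇ suc y)
  where
  positive : ℕ → Bool
  positive zero = false
  positive (suc _) = true

≡ᵇ-refl : ∀ n → (n ≡ᵇ n) ≡ true
≡ᵇ-refl zero = refl
≡ᵇ-refl (suc n) = ≡ᵇ-refl n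

suc≡ᵇ-false : ∀ n → (suc n ≡ᵇ n) ≡ false
suc≡ᵇ-false zero = refl
suc≡ᵇ-false (suc n) = suc≡ᵇ-false n

role₁ role₂ role₃ : Bool → Pt → Pt → Pt → Pt
role₁ true A B C = C
role₁ false A B C = A
role₂ true A B C = A
role₂ false A B C = B
role₃ true A B C = B
role₃ false A B C = C

nextTop nextLeft nextCorner : Pt → Pt → Pt → Pt → Pt
nextTop A B C r with aligned? A B C r
... | yes _ = shift (proj₁ (closingDirs (proj₁ r) (proj₂ r))) A
... | no _ = topMove (proj₁ A) (proj₂ A) (proj₁ r) (proj₂ r)
nextLeft A B C r with aligned? A B C r
... | yes _ = shift (proj₁ (proj₂ (closingDirs (proj₁ r) (proj₂ r)))) B
... | no _ = swap (topMove (proj₂ B) (proj₁ B) (proj₂ r) (proj₁ r))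
nextCorner A B C r with aligned? A B C r
... | yes _ = shift (proj₂ (proj₂ (closingDirs (proj₁ r) (proj₂ r)))) C
... | no _ = shift (cornerDir (proj₁ C) (proj₂ C) (proj₁ r) (proj₂ r)) C

Continues : ℕ → ℕ → Pt → Pt → Pt → Pt → ℕ × ℕ × ℕ → Set
Continues m n A B C r w =
  Σ (Phase (does (aligned? A B C r)) (nextTop A B C r) (nextLeft A B C r) (nextCorner A B C r) r)
    λ s → measure m n _ _ _ _ _ s ≺³ w

continues-by-cases : ∀ m n A B C r w → (Aligned A B C r → (0 , toCorner m n r , 0) ≺³ w) →
  (¬ Aligned A B C r →
     let A' = topMove (proj₁ A) (proj₂ A) (proj₁ r) (proj₂ r)
         B' = swap (topMove (proj₂ B) (proj₁ B) (proj₂ r) (proj₁ r))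
         C' = shift (cornerDir (proj₁ C) (proj₂ C) (proj₁ r) (proj₂ r)) C
     in Σ (Phase false A' B' C' r) λ s → measure m n false A' B' C' r s ≺³ w) →
  Continues m n A B C r w
continues-by-cases m n A B C r w closed chasing with aligned? A B C r
... | yes al = closing-traps A B C r al , closed al
... | no nal = chasing nal

Hits : Pt → Pt → Set
Hits (x' , y') (a , b) = x' ≡ a × y' ≡ b

Move² : Pt → Pt → Set
Move² (x , y) (x' , y') = Move x y x' y'

-- A chasing round: the top and left cops keep their invariants; either
-- their total lag drops, or the robber approaches the corner, or he stays
-- and the corner cop approaches its aim (all lags 0 and not aligned means
-- only the corner cop is off its aim).
chase-round : ∀ m n A B C r r' (s : Phase false A B C r) → Move² r r' → ¬ Hits r' A → ¬ Hits r' B →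
  proj₁ r' < m → proj₂ r' < n → Continues m n A B C r' (measure m n false A B C r s)
chase-round m n (ax , ay) (bx , by) (cx , cy) (x , y) (x' , y') (ja , jb) mv missA missB xm yn =
  continues-by-cases m n _ _ _ _ _ (closing mv) (λ nal → (inv (roundA mv) , inv (roundB mv)) , chasing mv nal)
  where
  open TopRound
  missB′ : ¬ (y' ≡ by × x' ≡ bx)
  missB′ (e₁ , e₂) = missB (e₂ , e₁)
  roundA : (mv : Move x y x' y') → TopRound ja mv (topMove ax ay x' y')
  roundA mv = top-round ja mv missA
  roundB : (mv : Move x y x' y') → TopRound jb (transposeMove mv) (topMove by bx y' x')
  roundB mv = top-round jb (transposeMove mv) missB′

  closing : Move x y x' y' → Aligned (ax , ay) (bx , by) (cx , cy) (x' , y') →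
            (0 , toCorner m n (x' , y') , 0) ≺³ (lag ja + lag jb , toCorner m n (x , y) , suc (cornerLag (cx , cy) x y))
  closing stay _ = ≺-by₃≤ z≤n ≤-refl (s≤s z≤n)
  closing up _ = ≺-by₁ (≤-trans (≤-trans (s≤s z≤n) (shrinks (roundA up))) (m≤m+n _ _))
  closing left _ = ≺-by₁ (≤-trans (≤-trans (s≤s z≤n) (shrinks (roundB left))) (m≤n+m _ _))
  closing down _ = ≺-by₂≤ z≤n (toCorner-south m n x y xm)
  closing right _ = ≺-by₂≤ z≤n (toCorner-east m n x y yn)

  chasing : (mv : Move x y x' y') → ¬ Aligned (ax , ay) (bx , by) (cx , cy) (x' , y') →
            (lag (inv (roundA mv)) + lag (inv (roundB mv)) , toCorner m n (x' , y') ,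
             suc (cornerLag (shift (cornerDir cx cy x' y') (cx , cy)) x' y'))
            ≺³ (lag ja + lag jb , toCorner m n (x , y) , suc (cornerLag (cx , cy) x y))
  chasing stay nal with shrinks (roundA stay) | shrinks (roundB stay)
  ... | inj₁ p | _ = ≺-by₁ (+-mono-<-≤ p (lag≤ (roundB stay)))
  ... | inj₂ _ | inj₁ q = ≺-by₁ (+-mono-≤-< (lag≤ (roundA stay)) q)
  ... | inj₂ lagA≡0 | inj₂ lagB≡0 =
    ≺-by₃≤ (+-mono-≤ (lag≤ (roundA stay)) (lag≤ (roundB stay))) ≤-refl (s≤s (cornerDir-approaches cx cy x y cornerOff))
    where
    cornerOff : ¬ (cx ≡ pred x × cy ≡ pred y)
    cornerOff (c₁ , c₂) with lag0⇒aim ja lagA≡0 | lag0⇒aim jb lagB≡0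
    ... | (p₁ , p₂) | (q₁ , q₂) = nal (TopInv-off-origin ja , (p₁ , p₂) , (q₂ , q₁) , λ _ _ → c₁ , c₂)
  chasing up _ = ≺-by₁ (+-mono-<-≤ (shrinks (roundA up)) (lag≤ (roundB up)))
  chasing left _ = ≺-by₁ (+-mono-≤-< (lag≤ (roundA left)) (shrinks (roundB left)))
  chasing down _ = ≺-by₂≤ (+-mono-≤ (lag≤ (roundA down)) (lag≤ (roundB down))) (toCorner-south m n x y xm)
  chasing right _ = ≺-by₂≤ (+-mono-≤ (lag≤ (roundA right)) (lag≤ (roundB right))) (toCorner-east m n x y yn)

after-trap : ∀ m n A B C r' before {x₀ y₀ x₁ y₁}
  (ja : TopInv (proj₁ A) (proj₂ A) x₀ y₀) (mva : Move x₀ y₀ (proj₁ r') (proj₂ r')) →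
  ¬ (proj₁ r' ≡ proj₁ A × proj₂ r' ≡ proj₂ A) → lag ja ≡ 0 →
  (jb : TopInv (proj₂ B) (proj₁ B) y₁ x₁) (mvb : Move y₁ x₁ (proj₂ r') (proj₁ r')) →
  ¬ (proj₂ r' ≡ proj₂ B × proj₁ r' ≡ proj₁ B) → lag jb ≡ 0 →
  toCorner m n r' < before → Continues m n A B C r' (0 , before , 0)
after-trap m n A B C r' before ja mva missA lagA≡0 jb mvb missB lagB≡0 closer =
  continues-by-cases m n A B C r' _ (λ _ → ≺-by₂ refl closer)
    (λ _ → (inv roundA , inv roundB) ,
           ≺-by₂≤ (+-mono-≤ (≤-trans (lag≤ roundA) (≤-reflexive lagA≡0)) (≤-trans (lag≤ roundB) (≤-reflexive lagB≡0))) closer)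
  where
  open TopRound
  roundA = top-round ja mva missA
  roundB = top-round jb mvb missB

2+n≢n : ∀ k → suc (suc k) ≢ k
2+n≢n k e = <-irrefl (sym e) (<-trans (n<1+n k) (n<1+n (suc k)))

-- A trap round: the robber cannot stay or move up or left (a cop is
-- there), so he moves down or right, closer to the corner; the cops then
-- resume chasing, rotating roles after a move right from an inner trap.
trap-round : ∀ m n A B C r r' (s : Trap A B C r) → Move² r r' → ¬ Hits r' A → ¬ Hits r' B → ¬ Hits r' C →
  proj₁ r' < m → proj₂ r' < n →
  let ρ = rotates true r r' in Continues m n (role₁ ρ A B C) (role₂ ρ A B C) (role₃ ρ A B C) r' (0 , toCorner m n r , 0)
trap-round m n _ _ _ _ _ (trap-inner x₀ y₀) stay missA _ _ _ _ = ⊥-elim (missA (refl , refl))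
trap-round m n _ _ _ _ _ (trap-inner x₀ y₀) up _ _ missC _ _ = ⊥-elim (missC (refl , refl))
trap-round m n _ _ _ _ _ (trap-inner x₀ y₀) left _ missB _ _ _ = ⊥-elim (missB (refl , refl))
trap-round m n _ _ _ _ _ (trap-inner x₀ y₀) down _ _ _ xm _ rewrite suc≡ᵇ-false x₀ =
  after-trap m n _ _ _ _ _ (in-column 0 refl refl) stay (λ { (e , _) → 1+n≢n e }) refl
                           (in-column 0 refl refl) right (λ { (_ , e) → 1+n≢n e }) refl (toCorner-south m n (suc x₀) (suc y₀) xm)
trap-round m n _ _ _ _ _ (trap-inner x₀ y₀) right _ _ _ _ yn rewrite ≡ᵇ-refl x₀ | ≡ᵇ-refl y₀ =
  after-trap m n _ _ _ _ _ (in-column 0 refl refl) right (λ { (_ , e) → 1+n≢n e }) refl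
                           (in-column 0 refl refl) stay (λ { (e , _) → 1+n≢n e }) refl (toCorner-east m n (suc x₀) (suc y₀) yn)
trap-round m n _ _ _ _ _ (trap-row0 y₀ C) stay missA _ _ _ _ = ⊥-elim (missA (refl , refl))
trap-round m n _ _ _ _ _ (trap-row0 y₀ C) left _ missB _ _ _ = ⊥-elim (missB (refl , refl))
trap-round m n _ _ _ _ _ (trap-row0 y₀ C) down _ _ _ xm _ =
  after-trap m n _ _ _ _ _ (in-column 0 refl refl) stay (λ { (() , _) }) refl
                           (in-column 0 refl refl) right (λ { (_ , ()) }) refl (toCorner-south m n 0 (suc y₀) xm)
trap-round m n _ _ _ _ _ (trap-row0 y₀ C) right _ _ _ _ yn =
  after-trap m n _ _ _ _ _ (left-in-row0 0 refl refl refl) stay (λ { (_ , e) → 1+n≢n e }) refl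
                           (in-column 0 refl refl) down (λ { (e , _) → 2+n≢n _ e }) refl (toCorner-east m n 0 (suc y₀) yn)
trap-round m n _ _ _ _ _ (trap-col0 x₀ C) stay _ missB _ _ _ = ⊥-elim (missB (refl , refl))
trap-round m n _ _ _ _ _ (trap-col0 x₀ C) up missA _ _ _ _ = ⊥-elim (missA (refl , refl))
trap-round m n _ _ _ _ _ (trap-col0 x₀ C) down _ _ _ xm _ =
  after-trap m n _ _ _ _ _ (in-column 0 refl refl) down (λ { (e , _) → 2+n≢n _ e }) refl
                           (left-in-row0 0 refl refl refl) stay (λ { (_ , e) → 1+n≢n e }) refl (toCorner-south m n (suc x₀) 0 xm)
trap-round m n _ _ _ _ _ (trap-col0 x₀ C) right _ _ _ _ yn =
  after-trap m n _ _ _ _ _ (in-column 0 refl refl) right (λ { (_ , ()) }) refl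
                           (in-column 0 refl refl) stay (λ { (() , _) }) refl (toCorner-east m n (suc x₀) 0 yn)

phase-round : ∀ m n b A B C r r' (s : Phase b A B C r) → Move² r r' → ¬ Hits r' A → ¬ Hits r' B → ¬ Hits r' C →
  proj₁ r' < m → proj₂ r' < n →
  let ρ = rotates b r r' in Continues m n (role₁ ρ A B C) (role₂ ρ A B C) (role₃ ρ A B C) r' (measure m n b A B C r s)
phase-round m n false A B C r r' s mv missA missB _ xm yn = chase-round m n A B C r r' s mv missA missB xm yn
phase-round m n true A B C r r' s mv missA missB missC xm yn = trap-round m n A B C r r' s mv missA missB missC xm yn

topDir-inBounds : ∀ m n a b x y → x < m → y < n → InBounds m n (topDir a b x y) (a , b)
topDir-inBounds m n a b x y xm yn with topDir a b x y in eq
... | hold = tt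
... | north = tt
... | west = tt
... | south = <-trans (proj₂ (topDir-bounded a b x y) eq) xm
... | east = <-≤-trans (s≤s (proj₁ (topDir-bounded a b x y) eq)) (≤-trans (s≤s (aimCol≤ x y)) yn)

InBounds-transpose : ∀ m n d a b → InBounds n m d (b , a) → InBounds m n (transposeDir d) (a , b)
InBounds-transpose m n hold a b _ = tt
InBounds-transpose m n north a b _ = tt
InBounds-transpose m n south a b p = p
InBounds-transpose m n west a b _ = tt
InBounds-transpose m n east a b p = p

closingDirs-inBounds : ∀ m n A B C r → Aligned A B C r → proj₁ r < m → proj₂ r < n →
  let (dA , dB , dC) = closingDirs (proj₁ r) (proj₂ r) in InBounds m n dA A × InBounds m n dB B × InBounds m n dC C
closingDirs-inBounds m n A B C (zero , zero) (off , _) _ _ = ⊥-elim (off (refl , refl))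
closingDirs-inBounds m n _ B C (zero , suc y₀) (_ , (refl , refl) , _) _ yn = yn , tt , tt
closingDirs-inBounds m n A _ C (suc x₀ , zero) (_ , _ , (refl , refl) , _) xm _ = tt , xm , tt
closingDirs-inBounds m n _ B (cx , cy) (suc x₀ , suc y₀) (_ , (refl , refl) , _ , corner) xm yn
  with corner (s≤s z≤n) (s≤s z≤n)
... | refl , refl = xm , tt , yn

copDirs : Pt → Pt → Pt → Pt → Dir × Dir × Dir
copDirs A B C r with aligned? A B C r
... | yes _ = closingDirs (proj₁ r) (proj₂ r)
... | no _ = (topDir (proj₁ A) (proj₂ A) (proj₁ r) (proj₂ r) ,
              transposeDir (topDir (proj₂ B) (proj₁ B) (proj₂ r) (proj₁ r)) ,
              cornerDir (proj₁ C) (proj₂ C) (proj₁ r) (proj₂ r))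

nextTop-dir : ∀ A B C r → nextTop A B C r ≡ shift (proj₁ (copDirs A B C r)) A
nextTop-dir A B C r with aligned? A B C r
... | yes _ = refl
... | no _ = refl

nextLeft-dir : ∀ A B C r → nextLeft A B C r ≡ shift (proj₁ (proj₂ (copDirs A B C r))) B
nextLeft-dir A B C r with aligned? A B C r
... | yes _ = refl
... | no _ = sym (shift-transpose (topDir (proj₂ B) (proj₁ B) (proj₂ r) (proj₁ r)) (swap B))

nextCorner-dir : ∀ A B C r → nextCorner A B C r ≡ shift (proj₂ (proj₂ (copDirs A B C r))) C
nextCorner-dir A B C r with aligned? A B C r
... | yes _ = refl
... | no _ = refl

copDirs-inBounds : ∀ m n A B C r → proj₁ r < m → proj₂ r < n →
  let (dA , dB , dC) = copDirs A B C r in InBounds m n dA A × InBounds m n dB B × InBounds m n dC C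
copDirs-inBounds m n A B C r xm yn with aligned? A B C r
... | yes al = closingDirs-inBounds m n A B C r al xm yn
... | no _ = topDir-inBounds m n (proj₁ A) (proj₂ A) (proj₁ r) (proj₂ r) xm yn ,
             InBounds-transpose m n _ (proj₁ B) (proj₂ B) (topDir-inBounds n m (proj₂ B) (proj₁ B) (proj₂ r) (proj₁ r) yn xm) ,
             cornerDir-inBounds m n (proj₁ C) (proj₂ C) (proj₁ r) (proj₂ r) xm yn

module ThreeCops (m₀ n₀ : ℕ) where
  m n : ℕ
  m = suc m₀
  n = suc n₀

  open GridGraph m n using (G; Vx)

  coords : Vx → Pt
  coords (i , j) = (toℕ i , toℕ j)

  coords-injective : ∀ p q → Hits (coords p) (coords q) → p ≡ q
  coords-injective (i , j) (i' , j') (e₁ , e₂) = cong₂ _,_ (toℕ-injective e₁) (toℕ-injective e₂)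

  moveIn : Dir → Vx → Vx
  moveIn hold p = p
  moveIn north (i , j) = (predF i , j)
  moveIn south (i , j) = (sucF i , j)
  moveIn west (i , j) = (i , predF j)
  moveIn east (i , j) = (i , sucF j)

  moveIn-step : ∀ {k} d p → Step G k p (moveIn d p)
  moveIn-step hold p = inj₁ refl
  moveIn-step north (i , j) with predF-step i
  ... | inj₁ e = inj₁ (cong (_, j) e)
  ... | inj₂ a = inj₂ (inj₂ (refl , a))
  moveIn-step south (i , j) with sucF-step i
  ... | inj₁ e = inj₁ (cong (_, j) e)
  ... | inj₂ a = inj₂ (inj₂ (refl , a))
  moveIn-step west (i , j) with predF-step j
  ... | inj₁ e = inj₁ (cong (i ,_) e)
  ... | inj₂ a = inj₂ (inj₁ (refl , a))
  moveIn-step east (i , j) with sucF-step j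
  ... | inj₁ e = inj₁ (cong (i ,_) e)
  ... | inj₂ a = inj₂ (inj₁ (refl , a))

  coords-moveIn : ∀ d p → InBounds m n d (coords p) → coords (moveIn d p) ≡ shift d (coords p)
  coords-moveIn hold p _ = refl
  coords-moveIn north (i , j) _ = cong (_, toℕ j) (toℕ-predF i)
  coords-moveIn south (i , j) o = cong (_, toℕ j) (toℕ-sucF i o)
  coords-moveIn west (i , j) _ = cong (toℕ i ,_) (toℕ-predF j)
  coords-moveIn east (i , j) o = cong (toℕ i ,_) (toℕ-sucF j o)

  step⇒move : ∀ {k} r r' → Step G k r r' → Move² (coords r) (coords r')
  step⇒move r .r (inj₁ refl) = stay
  step⇒move (i , j) (i' , j') (inj₂ (inj₁ (e , inj₁ a))) = right′ (cong toℕ e) a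
    where
    right′ : ∀ {x y x' y'} → x ≡ x' → suc y ≡ y' → Move x y x' y'
    right′ refl refl = right
  step⇒move (i , j) (i' , j') (inj₂ (inj₁ (e , inj₂ a))) = left′ (cong toℕ e) a
    where
    left′ : ∀ {x y x' y'} → x ≡ x' → suc y' ≡ y → Move x y x' y'
    left′ refl refl = left
  step⇒move (i , j) (i' , j') (inj₂ (inj₂ (e , inj₁ a))) = down′ (cong toℕ e) a
    where
    down′ : ∀ {x y x' y'} → y ≡ y' → suc x ≡ x' → Move x y x' y'
    down′ refl refl = down
  step⇒move (i , j) (i' , j') (inj₂ (inj₂ (e , inj₂ a))) = up′ (cong toℕ e) a
    where
    up′ : ∀ {x y x' y'} → y ≡ y' → suc x' ≡ x → Move x y x' y'
    up′ refl refl = up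

  -- Roles: ρ names the top cop; the next cop (cyclically) is the left cop
  -- and the one after it the corner cop.
  leftCop cornerCop : Fin 3 → Fin 3
  leftCop zero = suc zero
  leftCop (suc zero) = suc (suc zero)
  leftCop (suc (suc zero)) = zero
  cornerCop zero = suc (suc zero)
  cornerCop (suc zero) = zero
  cornerCop (suc (suc zero)) = suc zero

  topAt leftAt cornerAt : Fin 3 → Config G 3 → Pt
  topAt ρ c = coords (c ρ)
  leftAt ρ c = coords (c (leftCop ρ))
  cornerAt ρ c = coords (c (cornerCop ρ))

  dirsFor : Fin 3 → Config G 3 → Vx → Dir × Dir × Dir
  dirsFor ρ c r = copDirs (topAt ρ c) (leftAt ρ c) (cornerAt ρ c) (coords r)

  dirOf : Fin 3 → Fin 3 → Dir × Dir × Dir → Dir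
  dirOf zero zero ds = proj₁ ds
  dirOf zero (suc zero) ds = proj₁ (proj₂ ds)
  dirOf zero (suc (suc zero)) ds = proj₂ (proj₂ ds)
  dirOf (suc zero) (suc zero) ds = proj₁ ds
  dirOf (suc zero) (suc (suc zero)) ds = proj₁ (proj₂ ds)
  dirOf (suc zero) zero ds = proj₂ (proj₂ ds)
  dirOf (suc (suc zero)) (suc (suc zero)) ds = proj₁ ds
  dirOf (suc (suc zero)) zero ds = proj₁ (proj₂ ds)
  dirOf (suc (suc zero)) (suc zero) ds = proj₂ (proj₂ ds)

  dirOf-top : ∀ ρ ds → dirOf ρ ρ ds ≡ proj₁ ds
  dirOf-top zero ds = refl
  dirOf-top (suc zero) ds = refl
  dirOf-top (suc (suc zero)) ds = refl

  dirOf-left : ∀ ρ ds → dirOf ρ (leftCop ρ) ds ≡ proj₁ (proj₂ ds)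
  dirOf-left zero ds = refl
  dirOf-left (suc zero) ds = refl
  dirOf-left (suc (suc zero)) ds = refl

  dirOf-corner : ∀ ρ ds → dirOf ρ (cornerCop ρ) ds ≡ proj₂ (proj₂ ds)
  dirOf-corner zero ds = refl
  dirOf-corner (suc zero) ds = refl
  dirOf-corner (suc (suc zero)) ds = refl

  copsReply : Fin 3 → Config G 3 → Vx → Config G 3
  copsReply ρ c r i = moveIn (dirOf ρ i (dirsFor ρ c r)) (c i)

  module _ (ρ : Fin 3) (c : Config G 3) (r : Vx) where
    private
      A B C : Pt
      A = topAt ρ c
      B = leftAt ρ c
      C = cornerAt ρ c
      bounds = copDirs-inBounds m n A B C (coords r) (toℕ<n _) (toℕ<n _)

    topAt-reply : topAt ρ (copsReply ρ c r) ≡ nextTop A B C (coords r)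
    topAt-reply rewrite dirOf-top ρ (dirsFor ρ c r) =
      trans (coords-moveIn _ (c ρ) (proj₁ bounds)) (sym (nextTop-dir A B C (coords r)))

    leftAt-reply : leftAt ρ (copsReply ρ c r) ≡ nextLeft A B C (coords r)
    leftAt-reply rewrite dirOf-left ρ (dirsFor ρ c r) =
      trans (coords-moveIn _ (c (leftCop ρ)) (proj₁ (proj₂ bounds))) (sym (nextLeft-dir A B C (coords r)))

    cornerAt-reply : cornerAt ρ (copsReply ρ c r) ≡ nextCorner A B C (coords r)
    cornerAt-reply rewrite dirOf-corner ρ (dirsFor ρ c r) =
      trans (coords-moveIn _ (c (cornerCop ρ)) (proj₂ (proj₂ bounds))) (sym (nextCorner-dir A B C (coords r)))

  rotateIf : Bool → Fin 3 → Fin 3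
  rotateIf true ρ = cornerCop ρ
  rotateIf false ρ = ρ

  roles-rotate : ∀ b ρ c → (topAt (rotateIf b ρ) c ≡ role₁ b (topAt ρ c) (leftAt ρ c) (cornerAt ρ c))
                         × (leftAt (rotateIf b ρ) c ≡ role₂ b (topAt ρ c) (leftAt ρ c) (cornerAt ρ c))
                         × (cornerAt (rotateIf b ρ) c ≡ role₃ b (topAt ρ c) (leftAt ρ c) (cornerAt ρ c))
  roles-rotate false ρ c = refl , refl , refl
  roles-rotate true zero c = refl , refl , refl
  roles-rotate true (suc zero) c = refl , refl , refl
  roles-rotate true (suc (suc zero)) c = refl , refl , refl

  nextRole : Fin 3 → Config G 3 → Vx → Vx → Fin 3
  nextRole ρ c r r' = rotateIf (rotates (does (aligned? (topAt ρ c) (leftAt ρ c) (cornerAt ρ c) (coords r))) (coords r) (coords r')) ρ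

  -- the roles are recomputed from the history of the play
  roleAfter : List (Config G 3 × Vx) → Vx → Fin 3
  roleAfter [] r = zero
  roleAfter ((c , r₀) ∷ h) r = nextRole (roleAfter h r₀) c r₀ r

  strategy : CopStrategy G 3
  strategy = record
    { start = λ _ → (zero , zero)
    ; next = λ h c r → copsReply (roleAfter h r) c r
    ; legal = λ h c r i → moveIn-step {3} (dirOf (roleAfter h r) i (dirsFor (roleAfter h r) c r)) (c i)
    }

  PhaseAfter : Pt → Pt → Pt → Pt → Set
  PhaseAfter A B C r = Phase (does (aligned? A B C r)) (nextTop A B C r) (nextLeft A B C r) (nextCorner A B C r) r

  measureAfter : ∀ {A B C r} → PhaseAfter A B C r → ℕ × ℕ × ℕ
  measureAfter {A} {B} {C} {r} s = measure m n (does (aligned? A B C r)) (nextTop A B C r) (nextLeft A B C r) (nextCorner A B C r) r s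

  GridPhase : Fin 3 → Config G 3 → Vx → Set
  GridPhase ρ c r = PhaseAfter (topAt ρ c) (leftAt ρ c) (cornerAt ρ c) (coords r)

  continues-along : ∀ {A B C A' B' C' r w} → A ≡ A' → B ≡ B' → C ≡ C' → Continues m n A' B' C' r w →
                    Σ (PhaseAfter A B C r) λ s → measureAfter s ≺³ w
  continues-along refl refl refl p = p

  grid-round : ∀ ρ c r r' (s : GridPhase ρ c r) → Step G 3 r r' → ¬ Occupied G 3 (copsReply ρ c r) r' →
               Σ (GridPhase (nextRole ρ c r r') (copsReply ρ c r) r') λ s' → measureAfter s' ≺³ measureAfter s
  grid-round ρ c r r' s st free =
    continues-along (trans (proj₁ rot) (same role₁)) (trans (proj₁ (proj₂ rot)) (same role₂))
                    (trans (proj₂ (proj₂ rot)) (same role₃))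
      (phase-round m n b _ _ _ (coords r) (coords r') s (step⇒move {3} r r' st)
         (miss ρ (topAt-reply ρ c r)) (miss (leftCop ρ) (leftAt-reply ρ c r)) (miss (cornerCop ρ) (cornerAt-reply ρ c r))
         (toℕ<n _) (toℕ<n _))
    where
    b = does (aligned? (topAt ρ c) (leftAt ρ c) (cornerAt ρ c) (coords r))
    ρ′ = rotates b (coords r) (coords r')
    c′ = copsReply ρ c r
    rot = roles-rotate ρ′ ρ c′
    same : ∀ (f : Bool → Pt → Pt → Pt → Pt) →
           f ρ′ (topAt ρ c′) (leftAt ρ c′) (cornerAt ρ c′) ≡
           f ρ′ (nextTop _ _ _ (coords r)) (nextLeft _ _ _ (coords r)) (nextCorner _ _ _ (coords r))
    same f = cong₂ (λ A (BC : Pt × Pt) → f ρ′ A (proj₁ BC) (proj₂ BC))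
                   (topAt-reply ρ c r) (cong₂ _,_ (leftAt-reply ρ c r) (cornerAt-reply ρ c r))
    miss : ∀ i {X} → coords (c′ i) ≡ X → ¬ Hits (coords r') X
    miss i refl hit = free (i , sym (coords-injective r' (c′ i) hit))

  topInv-from-origin : ∀ x y → ¬ (x ≡ 0 × y ≡ 0) → TopInv 0 0 x y
  topInv-from-origin zero zero off = ⊥-elim (off (refl , refl))
  topInv-from-origin zero (suc y) _ = left-in-row0 y refl refl (cong suc (sym (+-identityʳ y)))
  topInv-from-origin (suc x) y _ = top-row y x refl refl (sym (+-identityʳ y))

  module OnPlay (p : Play G 3 strategy) where
    role : ℕ → Fin 3
    role t = roleAfter (history G 3 (cops p) (robber p) t) (robber p t)

    initial : GridPhase (role 0) (cops p 0) (robber p 0)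
    initial with cops p 0 | cops₀ p | robber₀ p
    ... | .(λ _ → (zero , zero)) | refl | free =
      proj₁ (phase-round m n false (0 , 0) (0 , 0) (0 , 0) r₀ r₀
               (topInv-from-origin _ _ off , topInv-from-origin _ _ (λ { (a , b) → off (b , a) }))
               stay off off off (toℕ<n _) (toℕ<n _))
      where
      r₀ = coords (robber p 0)
      off : ¬ (proj₁ r₀ ≡ 0 × proj₂ r₀ ≡ 0)
      off e = free (zero , sym (coords-injective (robber p 0) (zero , zero) e))

    advance : ∀ t (s : GridPhase (role t) (cops p t) (robber p t)) →
              Σ (GridPhase (role (suc t)) (cops p (suc t)) (robber p (suc t))) λ s' → measureAfter s' ≺³ measureAfter s
    advance t s rewrite copsMv p t =
      grid-round (role t) (cops p t) (robber p t) (robber p (suc t)) s (robMv p t)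
        (subst (λ c' → ¬ Occupied G 3 c' (robber p (suc t))) (copsMv p t) (robFree p t))

    impossible : ⊥
    impossible = no-infinite-descent ≺³-wellFounded (λ t → GridPhase (role t) (cops p t) (robber p t))
                                     measureAfter initial advance

  three-cops-win : CopsWin G 3
  three-cops-win = strategy , λ p → ⊥-elim (OnPlay.impossible p)

fewer-than-two-lose : ∀ a b j → 1 ≤ j → j < 2 → ¬ CopsWin (Path (suc (suc a)) □ Path (suc (suc b))) j
fewer-than-two-lose a b (suc zero) _ _ = one-cop-loses a b
fewer-than-two-lose a b (suc (suc j)) _ (s≤s (s≤s ()))

fewer-than-three-lose : ∀ a b j → 1 ≤ j → j < 3 → ¬ CopsWin (Path (suc (suc a)) □ Path (suc (suc (suc (suc b))))) j
fewer-than-three-lose a b (suc zero) _ _ = one-cop-loses a (suc (suc b))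
fewer-than-three-lose a b (suc (suc zero)) _ _ = two-cops-lose a b
fewer-than-three-lose a b (suc (suc (suc j))) _ (s≤s (s≤s (s≤s ())))

σ-small-grids : ∀ m₁ n₁ → suc (suc m₁) ≤ suc (suc n₁) → suc (suc m₁) ≤ 3 × suc (suc n₁) ≤ 3 →
                SurroundingCopNumberIs (Path (suc (suc m₁)) □ Path (suc (suc n₁))) 2
σ-small-grids zero zero _ _ = s≤s z≤n , two-cops-win-2×2 , fewer-than-two-lose 0 0
σ-small-grids zero (suc zero) _ _ = s≤s z≤n , two-cops-win-2×3 , fewer-than-two-lose 0 1
σ-small-grids (suc zero) (suc zero) _ _ = s≤s z≤n , two-cops-win-3×3 , fewer-than-two-lose 1 1
σ-small-grids (suc zero) zero (s≤s (s≤s ())) _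
σ-small-grids (suc (suc _)) _ _ (s≤s (s≤s (s≤s ())) , _)
σ-small-grids _ (suc (suc _)) _ (_ , s≤s (s≤s (s≤s ())))

σ-wide-grids : ∀ m₁ n₂ → SurroundingCopNumberIs (Path (suc (suc m₁)) □ Path (suc (suc (suc (suc n₂))))) 3
σ-wide-grids m₁ n₂ = s≤s z≤n , ThreeCops.three-cops-win (suc m₁) (suc (suc (suc n₂))) , fewer-than-three-lose m₁ n₂

theorem17 : ∀ (m n : ℕ) → 2 ≤ m → m ≤ n →
    ((m ≤ 3 × n ≤ 3) → SurroundingCopNumberIs (Path m □ Path n) 2)
    × (¬ (m ≤ 3 × n ≤ 3) → SurroundingCopNumberIs (Path m □ Path n) 3)
theorem17 (suc (suc m₁)) (suc (suc n₁)) (s≤s (s≤s z≤n)) m≤n = σ-small-grids m₁ n₁ m≤n , large n₁ m≤n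
  where
  large : ∀ n₁ → suc (suc m₁) ≤ suc (suc n₁) → ¬ (suc (suc m₁) ≤ 3 × suc (suc n₁) ≤ 3) →
          SurroundingCopNumberIs (Path (suc (suc m₁)) □ Path (suc (suc n₁))) 3
  large zero m≤n notSmall = ⊥-elim (notSmall (≤-trans m≤n (s≤s (s≤s z≤n)) , s≤s (s≤s z≤n)))
  large (suc zero) m≤n notSmall = ⊥-elim (notSmall (m≤n , ≤-refl))
  large (suc (suc n₂)) _ _ = σ-wide-grids m₁ n₂
theorem17 (suc (suc m₁)) (suc zero) (s≤s (s≤s z≤n)) (s≤s ())
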